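{- Let $k\in\omega\setminus\{0,1\}$, let $\psi$ be a bounded complexity measure and let $T\in\mathcal{M}_k^{\infty}\setminus\mathcal{M}_k^{\infty c}$. Then $\psi^a(T)=\max\{M_\psi(T,\bar\delta):\bar\delta\in\Delta(T)\}$.
   Context: Let $\omega=\{0,1,2,\ldots\}$, let $\mathcal{P}(\omega)$ be the set of nonempty finite subsets of $\omega$, and for $k\in\omega\setminus\{0,1\}$ let $E_k=\{0,\ldots,k-1\}$. Let $P=\{f_i:i\in\omega\}$ be a set of attributes ($f_i\neq f_j$ iff $i\neq j$). $\mathcal{M}_k^{\infty}$ is the set of rectangular tables filled with numbers from $E_k$ whose rows are pairwise different, each row labeled with a set from $\mathcal{P}(\omega)$ (its set of decisions), and whose columns are labeled with pairwise different attributes from $P$; tables with no rows, all denoted $\Lambda$, also belong to $\mathcal{M}_k^{\infty}$. For $T\in\mathcal{M}_k^\infty$: $\Delta(T)$ is its set of rows, $\operatorname{At}(T)$ its set of column attributes, $\Pi(T)$ the intersection of the decision sets of all rows. $\mathcal{M}_k^{\infty c}$ is the set of tables in $\mathcal{M}_k^\infty$ with $\Pi(T)\neq\emptyset$, together with $\Lambda$. For a word $\alpha=(f_{i_1},\delta_1)\cdots(f_{i_m},\delta_m)$ with $f_{i_j}\in\operatorname{At}(T)$, $\delta_j\in E_k$, $T\alpha$ is the subtable of rows having $\delta_1,\ldots,\delta_m$ in the columns labeled $f_{i_1},\ldots,f_{i_m}$ respectively ($T\lambda=T$ for the empty word $\lambda$). Decision trees: a $k$-decision tree is a finite directed rooted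 tree with at least two nodes, where the root and edges leaving it are unlabeled, terminal nodes are labeled with decisions from $\omega$, and every other node is labeled with an attribute from $P$, each edge leaving it labeled with a number from $E_k$. $\operatorname{At}(\Gamma)$ is the set of attributes labeling its nodes. For a complete path $\tau=v_1,d_1,\ldots,v_m,d_m,v_{m+1}$ (root to a terminal node), $\pi(\tau)=\lambda$ if $m=1$, otherwise $\pi(\tau)=(f_{i_2},\delta_2)\cdots(f_{i_m},\delta_m)$ where $v_j$ is labeled $f_{i_j}$ and $d_j$ is labeled $\delta_j$; $T(\tau)=T\pi(\tau)$. For nonempty $T$, a nondeterministic decision tree for $T$ is a $k$-decision tree $\Gamma$ with $\operatorname{At}(\Gamma)\subseteq\operatorname{At}(T)$ such that each row of $T$ belongs to $T(\tau)$ for some complete path $\tau$, and for each complete path $\tau$ either $T(\tau)=\Lambda$ or the decision at its terminal node lies in $\Pi(T(\tau))$. Complexity measures: $P^*$ is the set of finite words over $P$ (including $\lambda$). A partially bounded complexity measure is $\psi:P^*\to\omega$ with: $\psi(\alpha)=0$ iff $\alpha=\lambda$; $\psi$ invariant under permutation of letters; $\psi(\alpha_1)\le\psi(\alpha_1\alpha_2)$; $\psi(\alpha_1\alpha_2)\le\psi(\alpha_1)+\psi(\alpha_2)$. It is bounded if also $\psi(\alpha)\ge|\alpha|$ for all $\alpha$. Extend $\psi$ to words over pairs by $\psi((f_{i_1},\delta_1)\cdots(f_{i_m},\delta_m))=\psi(f_{i_1}\cdots f_{i_m})$, $\psi(\lambda)=0$, and to trees by $\psi(\Gamma)=\max_\tau\psi(\pi(\tau))$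 over complete paths. For nonempty $T$, $\psi^a(T)$ is the minimum of $\psi(\Gamma)$ over nondeterministic decision trees for $T$. $M_\psi(T,\bar\delta)$: for $T\notin\mathcal{M}_k^{\infty c}$ with columns labeled $f_{t_1},\ldots,f_{t_n}$ and $\bar\delta=(\delta_1,\ldots,\delta_n)\in E_k^n$, $M_\psi(T,\bar\delta)$ is the minimum $p\in\omega$ for which there exist attributes $f_{t_{i_1}},\ldots,f_{t_{i_m}}\in\operatorname{At}(T)$ with $T(f_{t_{i_1}},\delta_{i_1})\cdots(f_{t_{i_m}},\delta_{i_m})\in\mathcal{M}_k^{\infty c}$ and $\psi(f_{t_{i_1}}\cdots f_{t_{i_m}})=p$ (with $m=0$ allowed, giving the empty word). -}

module Defs where

open import Data.Nat using (ℕ; _≤_; _+_)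
open import Data.Fin using (Fin)
open import Data.Vec using (Vec; lookup)
open import Data.List using (List; []; _∷_; _++_; map; length)
open import Data.List.NonEmpty using (List⁺; toList)
open import Data.List.Membership.Propositional using (_∈_)
open import Data.List.Relation.Unary.All using (All)
open import Data.List.Relation.Unary.AllPairs using (AllPairs)
open import Data.List.Relation.Binary.Permutation.Propositional using (_↭_)
open import Data.Product using (Σ; ∃; _×_; _,_; proj₁; proj₂)
open import Data.Sum using (_⊎_)
open import Relation.Binary.PropositionalEquality using (_≡_; _≢_)
open import Relation.Nullary using (¬_)
open import Function.Definitions using (Injective)

-- The attribute f_i is identified with the natural number i.
-- A word over P is a List ℕ.

record BoundedComplexityMeasure : Set where
  field
    ψ           : List ℕ → ℕ
    zero⇒λ      : ∀ α → ψ α ≡ 0 → α ≡ []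
    λ⇒zero      : ψ [] ≡ 0
    perm-inv    : ∀ α β → α ↭ β → ψ α ≡ ψ β
    monotone    : ∀ α₁ α₂ → ψ α₁ ≤ ψ (α₁ ++ α₂)
    subadditive : ∀ α₁ α₂ → ψ (α₁ ++ α₂) ≤ ψ α₁ + ψ α₂
    bounded     : ∀ α → length α ≤ ψ α

-- A row: a tuple of values from E_k (= Fin k) together with its
-- (nonempty, finite) set of decisions.
Row : ℕ → ℕ → Set
Row k n = Vec (Fin k) n × List⁺ ℕ

record Table (k : ℕ) : Set where
  field
    n        : ℕ
    attr     : Fin n → ℕ             -- column j is labeled f_(attr j)
    attr-inj : Injective _≡_ _≡_ attr
    rows     : List (Row k n)
    rows-distinct : AllPairs (λ r r′ → proj₁ r ≢ proj₁ r′) rows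

open Table public

PWord : ℕ → Set
PWord k = List (ℕ × Fin k)

-- the tuple v has value δ in the column labeled f, for each (f,δ) in w;
-- i.e. the row belongs to Tw
Sat : ∀ {k} (T : Table k) → Vec (Fin k) (n T) → PWord k → Set
Sat T v w = All (λ p → ∃ λ j → attr T j ≡ proj₁ p × lookup v j ≡ proj₂ p) w

_∈dec_ : ∀ {k m} → ℕ → Row k m → Set
d ∈dec r = d ∈ toList (proj₂ r)

IsEmptySub : ∀ {k} (T : Table k) → PWord k → Set
IsEmptySub T w = ∀ r → r ∈ rows T → ¬ Sat T (proj₁ r) w

InΠ : ∀ {k} (T : Table k) → PWord k → ℕ → Set
InΠ T w d = ∀ r → r ∈ rows T → Sat T (proj₁ r) w → d ∈dec r

InMc : ∀ {k} (T : Table k) → PWord k → Set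
InMc T w = IsEmptySub T w ⊎ (∃ λ d → InΠ T w d)

ψw : ∀ {k} → BoundedComplexityMeasure → PWord k → ℕ
ψw Ψ w = BoundedComplexityMeasure.ψ Ψ (map proj₁ w)

IsMinimum : (ℕ → Set) → ℕ → Set
IsMinimum P m = P m × (∀ p → P p → m ≤ p)

IsMaximum : (ℕ → Set) → ℕ → Set
IsMaximum P m = P m × (∀ p → P p → p ≤ m)

data Node (k : ℕ) : Set where
  leaf : ℕ → Node k
  node : ℕ → List⁺ (Fin k × Node k) → Node k

record DTree (k : ℕ) : Set where
  constructor root
  field children : List⁺ (Node k)

data PathN {k : ℕ} : Node k → PWord k → ℕ → Set where
  leafP : ∀ {d} → PathN (leaf d) [] d
  stepP : ∀ {f cs δ c w d} → (δ , c) ∈ toList cs → PathN c w d →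
          PathN (node f cs) ((f , δ) ∷ w) d

CPath : ∀ {k} → DTree k → PWord k → ℕ → Set
CPath (root cs) w d = ∃ λ c → c ∈ toList cs × PathN c w d

data AtN {k : ℕ} (f : ℕ) : Node k → Set where
  here  : ∀ {cs} → AtN f (node f cs)
  there : ∀ {g cs δ c} → (δ , c) ∈ toList cs → AtN f c → AtN f (node g cs)

AtT : ∀ {k} → ℕ → DTree k → Set
AtT f (root cs) = ∃ λ c → c ∈ toList cs × AtN f c

IsNondetTree : ∀ {k} → Table k → DTree k → Set
IsNondetTree T Γ =
  (∀ f → AtT f Γ → ∃ λ j → attr T j ≡ f) ×
  (∀ r → r ∈ rows T → ∃ λ w → ∃ λ d → CPath Γ w d × Sat T (proj₁ r) w) ×
  (∀ w d → CPath Γ w d → IsEmptySub T w ⊎ InΠ T w d)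

TreeCost : ∀ {k} → BoundedComplexityMeasure → DTree k → ℕ → Set
TreeCost Ψ Γ = IsMaximum (λ p → ∃ λ w → ∃ λ d → CPath Γ w d × ψw Ψ w ≡ p)

IsPsiA : ∀ {k} → BoundedComplexityMeasure → Table k → ℕ → Set
IsPsiA Ψ T = IsMinimum (λ p → ∃ λ Γ → IsNondetTree T Γ × TreeCost Ψ Γ p)

-- M_ψ(T, v) = m  (the attributes are given by a list of column indices)
IsM : ∀ {k} → BoundedComplexityMeasure → (T : Table k) → Vec (Fin k) (n T) → ℕ → Set
IsM Ψ T v = IsMinimum (λ p → ∃ λ (is : List (Fin (n T))) →
  InMc T (map (λ j → attr T j , lookup v j) is) ×
  BoundedComplexityMeasure.ψ Ψ (map (attr T) is) ≡ p)

{-# OPTIONS --safe #-}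
module Submission where

-- For every row δ̄ fix a cheapest word certifying M_ψ(T, δ̄) and hang it from the root as a
-- chain ending in a decision common to its subtable: this nondeterministic tree covers every
-- row and costs max M_ψ(T, δ̄). Conversely, in any nondeterministic tree for T the path
-- covering δ̄ is itself such a certifying word, so the tree costs at least M_ψ(T, δ̄).

open import Defs
open import Data.Nat using (ℕ; zero; suc; _≤_; _<_; z≤n; s≤s)
open import Data.Nat.Properties
  using (≤-trans; ≤-antisym; ≮⇒≥; ≤-totalOrder; anyUpTo?) renaming (_≟_ to _≟ℕ_)
open import Data.Nat.Induction using (<-rec)
open import Data.Fin using (Fin)
open import Data.Fin.Properties using (any?) renaming (_≟_ to _≟ᶠ_)
open import Data.Vec using (Vec; lookup)
open import Data.Vec.Relation.Binary.Pointwise.Inductive using (Pointwise-≡⇒≡)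
open import Data.Vec.Relation.Binary.Pointwise.Extensional using (ext; extensional⇒inductive)
open import Data.List using (List; []; _∷_; map; length; allFin)
open import Data.List.Properties using (length-map; map-∘)
open import Data.List.NonEmpty using (List⁺; toList)
  renaming (_∷_ to _∷⁺_; head to head⁺; map to map⁺)
open import Data.List.Relation.Unary.Any using (here; there) renaming (any? to anyᴸ?)
open import Data.List.Relation.Unary.All using (All; []; _∷_; all?)
import Data.List.Relation.Unary.All as All
open import Data.List.Relation.Unary.AllPairs using (AllPairs; _∷_)
open import Data.List.Membership.Propositional using (_∈_; find; lose)
open import Data.List.Membership.Propositional.Properties using (∈-map⁺; ∈-map⁻; ∈-allFin)
open import Data.List.Membership.DecPropositional _≟ℕ_ using (_∈?_)
open import Data.List.Extrema ≤-totalOrder using (argmax; argmax-all; f[xs]≤f[argmax])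
open import Data.Product using (Σ; ∃; _×_; _,_; proj₁; proj₂; uncurry)
open import Data.Sum using (_⊎_; inj₁; inj₂; [_,_]′; map₂)
open import Data.Empty using (⊥-elim)
open import Function using (_∘_; id)
open import Relation.Nullary using (¬_; Dec; yes; no)
open import Relation.Nullary.Decidable using (map′; _×-dec_; _→-dec_)
open import Relation.Binary.PropositionalEquality using (_≡_; _≢_; refl; sym; trans; cong; subst)

lookup-ext : ∀ {A : Set} {m} {u v : Vec A m} → (∀ i → lookup u i ≡ lookup v i) → u ≡ v
lookup-ext u≗v = Pointwise-≡⇒≡ (extensional⇒inductive (ext u≗v))

∈-proj₁-injective : ∀ {A B : Set} {xs : List (A × B)} →
                    AllPairs (λ x y → proj₁ x ≢ proj₁ y) xs →
                    ∀ {x y} → x ∈ xs → y ∈ xs → proj₁ x ≡ proj₁ y → x ≡ y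
∈-proj₁-injective (_ ∷ _)      (here refl) (here refl) _  = refl
∈-proj₁-injective (x≢ ∷ _)     (here refl) (there y∈) eq = ⊥-elim (All.lookup x≢ y∈ eq)
∈-proj₁-injective (y≢ ∷ _)     (there x∈) (here refl) eq = ⊥-elim (All.lookup y≢ x∈ (sym eq))
∈-proj₁-injective (_ ∷ unique) (there x∈) (there y∈) eq = ∈-proj₁-injective unique x∈ y∈ eq

∈-nonempty : ∀ {A : Set} {P : A → Set} (xs : List A) →
             ¬ (∀ x → x ∈ xs → P x) → ∃ (_∈ xs)
∈-nonempty []      none = ⊥-elim (none λ _ ())
∈-nonempty (x ∷ _) _    = x , here refl

IsMinimum-unique : ∀ {P m m′} → IsMinimum P m → IsMinimum P m′ → m ≡ m′
IsMinimum-unique (Pm , m≤) (Pm′ , m′≤) = ≤-antisym (m≤ _ Pm′) (m′≤ _ Pm)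

minimum : ∀ {P : ℕ → Set} → (∀ p → Dec (P p)) → ∀ b → P b → Σ ℕ (IsMinimum P)
minimum {P} P? = <-rec (λ b → P b → Σ ℕ (IsMinimum P)) step
  where
  step : ∀ b → (∀ {c} → c < b → P c → Σ ℕ (IsMinimum P)) → P b → Σ ℕ (IsMinimum P)
  step b smaller Pb with anyUpTo? P? b
  ... | yes (c , c<b , Pc) = smaller c<b Pc
  ... | no none            = b , Pb , λ p Pp → ≮⇒≥ λ p<b → none (p , p<b , Pp)

∃-length≤? : ∀ {m} {Q : List (Fin m) → Set} → (∀ is → Dec (Q is)) →
             ∀ b → Dec (∃ λ is → length is ≤ b × Q is)
∃-length≤? Q? b with Q? []
... | yes Q[] = yes ([] , z≤n , Q[])
∃-length≤? Q? zero    | no ¬Q[] = no λ { ([] , _ , Q[]) → ¬Q[] Q[] ; (_ ∷ _ , () , _) }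
∃-length≤? Q? (suc b) | no ¬Q[] =
  map′ (λ (j , is , l , Qj∷is) → j ∷ is , s≤s l , Qj∷is)
       (λ { ([] , _ , Q[]) → ⊥-elim (¬Q[] Q[]) ; (j ∷ is , s≤s l , Qj∷is) → j , is , l , Qj∷is })
       (any? λ j → ∃-length≤? (Q? ∘ (j ∷_)) b)

module _ {k} (T : Table k) where

  word : Vec (Fin k) (n T) → List (Fin (n T)) → PWord k
  word v = map (λ j → attr T j , lookup v j)

  attrs-word : ∀ v is → map (attr T) is ≡ map proj₁ (word v is)
  attrs-word v = map-∘

  Sat? : ∀ v w → Dec (Sat T v w)
  Sat? v = all? λ p → any? λ j → (attr T j ≟ℕ proj₁ p) ×-dec (lookup v j ≟ᶠ proj₂ p)

  InΠ? : ∀ w d → Dec (InΠ T w d)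
  InΠ? w d = map′ (λ all r r∈ → All.lookup all r∈) (λ Π → All.tabulate (Π _))
    (all? (λ r → Sat? (proj₁ r) w →-dec (d ∈? toList (proj₂ r))) (rows T))

  IsEmptySub-or-row : ∀ w → IsEmptySub T w ⊎ ∃ λ r → r ∈ rows T × Sat T (proj₁ r) w
  IsEmptySub-or-row w with anyᴸ? (λ r → Sat? (proj₁ r) w) (rows T)
  ... | no ¬some = inj₁ λ r r∈ s → ¬some (lose r∈ s)
  ... | yes some = inj₂ (find some)

  -- Π(Tw) lies inside the decision set of any row of Tw, a finite list to search.
  InMc? : ∀ w → Dec (InMc T w)
  InMc? w with IsEmptySub-or-row w
  ... | inj₁ empty          = yes (inj₁ empty)
  ... | inj₂ (r , r∈ , s) =
    map′ (λ some → let d , _ , Π = find some in inj₂ (d , Π))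
         [ (λ empty → ⊥-elim (empty r r∈ s)) , (λ (d , Π) → lose (Π r r∈ s) Π) ]′
         (anyᴸ? (InΠ? w) (toList (proj₂ r)))

  Sat-word : ∀ v is → Sat T v (word v is)
  Sat-word v []       = []
  Sat-word v (j ∷ is) = (j , refl , refl) ∷ Sat-word v is

  Sat-word⁻ : ∀ {u} v is → Sat T u (word v is) → All (λ j → lookup u j ≡ lookup v j) is
  Sat-word⁻ v []       []                         = []
  Sat-word⁻ {u} v (j ∷ is) ((_ , attr≡ , δ≡) ∷ s) with attr-inj T attr≡
  ... | refl = δ≡ ∷ Sat-word⁻ {u} v is s

  Sat⇒word : ∀ {v w} → Sat T v w → ∃ λ is → word v is ≡ w
  Sat⇒word {w = []}          []                   = [] , refl
  Sat⇒word {v} {(f , δ) ∷ w} ((j , refl , refl) ∷ s) =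
    let is , eq = Sat⇒word {v} s in j ∷ is , cong (_ ∷_) eq

  Sat-allFin⇒≡ : ∀ {u} v → Sat T u (word v (allFin (n T))) → u ≡ v
  Sat-allFin⇒≡ {u} v s = lookup-ext λ i → All.lookup (Sat-word⁻ {u} v _ s) (∈-allFin i)

  -- Fixing every column leaves at most one row, since rows are pairwise different.
  allFin-InMc : ∀ v → InMc T (word v (allFin (n T)))
  allFin-InMc v with IsEmptySub-or-row (word v (allFin (n T)))
  ... | inj₁ empty         = inj₁ empty
  ... | inj₂ (r₀ , r₀∈ , s₀) = inj₂ (head⁺ (proj₂ r₀) , λ r r∈ s →
    subst (head⁺ (proj₂ r₀) ∈dec_)
      (∈-proj₁-injective (rows-distinct T) r₀∈ r∈
        (trans (Sat-allFin⇒≡ v s₀) (sym (Sat-allFin⇒≡ v s))))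
      (here refl))

  -- When Tw = Λ every decision is admissible, so 0 is as good as any.
  decisionOf : ∀ {w} → InMc T w → ℕ
  decisionOf (inj₁ _)       = 0
  decisionOf (inj₂ (d , _)) = d

  decisionOf-sound : ∀ {w} (mc : InMc T w) → IsEmptySub T w ⊎ InΠ T w (decisionOf mc)
  decisionOf-sound (inj₁ empty)   = inj₁ empty
  decisionOf-sound (inj₂ (_ , Π)) = inj₂ Π

chain : ∀ {k} → PWord k → ℕ → Node k
chain []            d = leaf d
chain ((f , δ) ∷ w) d = node f ((δ , chain w d) ∷⁺ [])

PathN-chain : ∀ {k} (w : PWord k) d → PathN (chain w d) w d
PathN-chain []            d = leafP
PathN-chain ((f , δ) ∷ w) d = stepP (here refl) (PathN-chain w d)

PathN-chain⁻ : ∀ {k} (w : PWord k) d {w′ d′} → PathN (chain w d) w′ d′ → w′ ≡ w × d′ ≡ d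
PathN-chain⁻ []            d leafP                  = refl , refl
PathN-chain⁻ ((f , δ) ∷ w) d (stepP (here refl) p) with PathN-chain⁻ w d p
... | refl , refl = refl , refl
PathN-chain⁻ ((f , δ) ∷ w) d (stepP (there ()) _)

AtN-chain : ∀ {k} (w : PWord k) d {f} → AtN f (chain w d) → f ∈ map proj₁ w
AtN-chain ((f , δ) ∷ w) d here                   = here refl
AtN-chain ((f , δ) ∷ w) d (there (here refl) a) = there (AtN-chain w d a)
AtN-chain ((f , δ) ∷ w) d (there (there ()) _)

pathTree : ∀ {k} → List⁺ (PWord k × ℕ) → DTree k
pathTree ps = root (map⁺ (uncurry chain) ps)

CPath-pathTree⁺ : ∀ {k} (ps : List⁺ (PWord k × ℕ)) {w d} →
                  (w , d) ∈ toList ps → CPath (pathTree ps) w d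
CPath-pathTree⁺ (_ ∷⁺ _) {w} {d} wd∈ = chain w d , ∈-map⁺ (uncurry chain) wd∈ , PathN-chain w d

CPath-pathTree⁻ : ∀ {k} (ps : List⁺ (PWord k × ℕ)) {w d} →
                  CPath (pathTree ps) w d → (w , d) ∈ toList ps
CPath-pathTree⁻ (_ ∷⁺ _) (c , c∈ , path) with ∈-map⁻ (uncurry chain) c∈
... | (w , d) , wd∈ , refl with PathN-chain⁻ w d path
...   | refl , refl = wd∈

AtT-pathTree : ∀ {k} (ps : List⁺ (PWord k × ℕ)) {f} → AtT f (pathTree ps) →
               ∃ λ p → p ∈ toList ps × f ∈ map proj₁ (proj₁ p)
AtT-pathTree (_ ∷⁺ _) (c , c∈ , a) with ∈-map⁻ (uncurry chain) c∈
... | (w , d) , wd∈ , refl = (w , d) , wd∈ , AtN-chain w d a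

TreeCost-pathTree : ∀ {k} Ψ (ps : List⁺ (PWord k × ℕ)) {a} →
                    IsMaximum (λ m → ∃ λ p → p ∈ toList ps × ψw Ψ (proj₁ p) ≡ m) a →
                    TreeCost Ψ (pathTree ps) a
TreeCost-pathTree Ψ ps ((p , p∈ , ψ≡a) , ≤a) =
  (proj₁ p , proj₂ p , CPath-pathTree⁺ ps p∈ , ψ≡a) ,
  λ m (w , d , path , ψ≡m) → ≤a m ((w , d) , CPath-pathTree⁻ ps path , ψ≡m)

module Optimal {k} (Ψ : BoundedComplexityMeasure) (T : Table k) where
  open BoundedComplexityMeasure Ψ

  Cert : Vec (Fin k) (n T) → ℕ → Set
  Cert v p = ∃ λ is → InMc T (word T v is) × ψ (map (attr T) is) ≡ p

  length≤ψ : ∀ is → length is ≤ ψ (map (attr T) is)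
  length≤ψ is = subst (_≤ ψ (map (attr T) is)) (length-map (attr T) is) (bounded (map (attr T) is))

  -- Boundedness of ψ is what makes the search for a certificate of cost p finite.
  Cert? : ∀ v p → Dec (Cert v p)
  Cert? v p = map′ (λ (is , _ , c) → is , c)
    (λ (is , mc , ψ≡p) → is , subst (length is ≤_) ψ≡p (length≤ψ is) , mc , ψ≡p)
    (∃-length≤? (λ is → InMc? T (word T v is) ×-dec (ψ (map (attr T) is) ≟ℕ p)) p)

  -- Opaque because unfolding the well-founded search during unification is very costly.
  opaque
    M-exists : ∀ v → Σ ℕ (IsM Ψ T v)
    M-exists v = minimum (Cert? v) _ (allFin (n T) , allFin-InMc T v , refl)

  M : Vec (Fin k) (n T) → ℕ
  M v = proj₁ (M-exists v)

  M-cert : ∀ v → Cert v (M v)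
  M-cert v = proj₁ (proj₂ (M-exists v))

  M-least : ∀ v {p} → Cert v p → M v ≤ p
  M-least v c = proj₂ (proj₂ (M-exists v)) _ c

  M≤ψw : ∀ {v w} → Sat T v w → InMc T w → M v ≤ ψw Ψ w
  M≤ψw {v} s mc with Sat⇒word T {v} s
  ... | is , refl = M-least v (is , mc , cong ψ (attrs-word T v is))

  M≤treeCost : ∀ {Γ p r} → IsNondetTree T Γ → TreeCost Ψ Γ p → r ∈ rows T → M (proj₁ r) ≤ p
  M≤treeCost (_ , covers , consistent) (_ , ≤p) r∈ with covers _ r∈
  ... | w , d , path , s =
    ≤-trans (M≤ψw s (map₂ (d ,_) (consistent w d path))) (≤p _ (w , d , path , refl))

  bestWord : Vec (Fin k) (n T) → List (Fin (n T))
  bestWord v = proj₁ (M-cert v)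

  bestWord-InMc : ∀ v → InMc T (word T v (bestWord v))
  bestWord-InMc v = proj₁ (proj₂ (M-cert v))

  ψw-bestWord : ∀ v → ψw Ψ (word T v (bestWord v)) ≡ M v
  ψw-bestWord v = trans (cong ψ (sym (attrs-word T v (bestWord v)))) (proj₂ (proj₂ (M-cert v)))

  bestPath : Row k (n T) → PWord k × ℕ
  bestPath (v , _) = word T v (bestWord v) , decisionOf T (bestWord-InMc v)

  -- r₀ only serves to make the list of root children nonempty.
  bestPaths : Row k (n T) → List⁺ (PWord k × ℕ)
  bestPaths r₀ = bestPath r₀ ∷⁺ map bestPath (rows T)

  bestTree : Row k (n T) → DTree k
  bestTree r₀ = pathTree (bestPaths r₀)

  ∈-bestPaths⁻ : ∀ {r₀ p} → r₀ ∈ rows T → p ∈ map bestPath (r₀ ∷ rows T) →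
                 ∃ λ r → r ∈ rows T × p ≡ bestPath r
  ∈-bestPaths⁻ {r₀} r₀∈ p∈ with ∈-map⁻ bestPath {xs = r₀ ∷ rows T} p∈
  ... | r , here refl , eq = r , r₀∈ , eq
  ... | r , there r∈  , eq = r , r∈ , eq

  bestTree-nondet : ∀ {r₀} → r₀ ∈ rows T → IsNondetTree T (bestTree r₀)
  bestTree-nondet {r₀} r₀∈ = attrs , covers , consistent
    where
    attrs : ∀ f → AtT f (bestTree r₀) → ∃ λ j → attr T j ≡ f
    attrs f a with AtT-pathTree (bestPaths r₀) a
    ... | p , p∈ , f∈ with ∈-bestPaths⁻ r₀∈ p∈
    ...   | (v , _) , _ , refl
          with ∈-map⁻ (attr T) (subst (f ∈_) (sym (attrs-word T v (bestWord v))) f∈)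
    ...     | j , _ , refl = j , refl

    covers : ∀ r → r ∈ rows T → ∃ λ w → ∃ λ d → CPath (bestTree r₀) w d × Sat T (proj₁ r) w
    covers r r∈ =
      _ , _ , CPath-pathTree⁺ (bestPaths r₀) (there (∈-map⁺ bestPath r∈)) , Sat-word T (proj₁ r) _

    consistent : ∀ w d → CPath (bestTree r₀) w d → IsEmptySub T w ⊎ InΠ T w d
    consistent w d path with ∈-bestPaths⁻ r₀∈ (CPath-pathTree⁻ (bestPaths r₀) path)
    ... | (v , _) , _ , refl = decisionOf-sound T (bestWord-InMc v)

  rowMax : Row k (n T) → Row k (n T)
  rowMax r₀ = argmax (M ∘ proj₁) r₀ (rows T)

  rowMax∈ : ∀ {r₀} → r₀ ∈ rows T → rowMax r₀ ∈ rows T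
  rowMax∈ r₀∈ = argmax-all (M ∘ proj₁) r₀∈ (All.tabulate id)

  M≤M[rowMax] : ∀ r₀ {r} → r ∈ rows T → M (proj₁ r) ≤ M (proj₁ (rowMax r₀))
  M≤M[rowMax] r₀ r∈ = All.lookup (f[xs]≤f[argmax] r₀ (rows T)) r∈

  bestTree-cost : ∀ {r₀} → r₀ ∈ rows T → TreeCost Ψ (bestTree r₀) (M (proj₁ (rowMax r₀)))
  bestTree-cost {r₀} r₀∈ = TreeCost-pathTree Ψ (bestPaths r₀)
    ( (bestPath (rowMax r₀) , there (∈-map⁺ bestPath (rowMax∈ r₀∈)) , ψw-bestWord _)
    , λ { m (p , p∈ , ψ≡m) → bound m p p∈ ψ≡m })
    where
    bound : ∀ m p → p ∈ map bestPath (r₀ ∷ rows T) → ψw Ψ (proj₁ p) ≡ m →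
            m ≤ M (proj₁ (rowMax r₀))
    bound m p p∈ ψ≡m with ∈-bestPaths⁻ r₀∈ p∈
    ... | r , r∈ , refl =
      subst (_≤ _) (trans (sym (ψw-bestWord (proj₁ r))) ψ≡m) (M≤M[rowMax] r₀ r∈)

  M[rowMax]-max : ∀ {r₀} → r₀ ∈ rows T →
                  IsMaximum (λ m → ∃ λ r → r ∈ rows T × IsM Ψ T (proj₁ r) m) (M (proj₁ (rowMax r₀)))
  M[rowMax]-max {r₀} r₀∈ =
    (rowMax r₀ , rowMax∈ r₀∈ , proj₂ (M-exists _)) ,
    λ { m (r , r∈ , isM) →
          subst (_≤ _) (IsMinimum-unique (proj₂ (M-exists _)) isM) (M≤M[rowMax] r₀ r∈) }

lemma6 : (k : ℕ) → 2 ≤ k → (Ψ : BoundedComplexityMeasure) → (T : Table k) →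
    ¬ InMc T [] →
    Σ ℕ λ a → IsPsiA Ψ T a ×
    IsMaximum (λ m → ∃ λ r → r ∈ rows T × IsM Ψ T (proj₁ r) m) a
lemma6 k _ Ψ T ¬mc with ∈-nonempty (rows T) (¬mc ∘ inj₁)
... | r₀ , r₀∈ =
  M (proj₁ (rowMax r₀)) ,
  ( (bestTree r₀ , bestTree-nondet r₀∈ , bestTree-cost r₀∈)
  , λ { p (Γ , nondet , cost) → M≤treeCost nondet cost (rowMax∈ r₀∈) })
  , M[rowMax]-max r₀∈
  where open Optimal Ψ T
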